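{- Let $n\ge 1$ and $1\le k\le n$. The number of permutations of $[n]=\{1,\dots,n\}$ that avoid the pattern $123$ and whose first ascent is in position $k$ equals the $k$-fold Catalan convolution \[C_{n,k}=\frac{k}{2n-k}\binom{2n-k}{n}.\]
   Context: A permutation $\pi=\pi(1)\pi(2)\cdots\pi(n)$ of $[n]$ is $123$-avoiding if it has no indices $a<b<c$ with $\pi(a)<\pi(b)<\pi(c)$ (i.e., its longest increasing subsequence has length at most $2$). The first ascent of $\pi$ is in position $k$ if $k$ is the smallest index with $\pi(k)<\pi(k+1)$; by convention, the decreasing permutation $n(n-1)\cdots 21$, which has no ascent, is said to have its first ascent in position $n$. The Catalan convolution satisfies $C_{n,k}=\sum_{i_1+\cdots+i_k=n,\ i_r\ge 1}\prod_{r=1}^k C_{i_r-1}$, where $C_m=\frac{1}{m+1}\binom{2m}{m}$. -}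

module Defs where

open import Data.Nat using (ℕ; zero; suc; _+_; _*_; _∸_; _<_; _≤_)
import Data.Nat.Properties as ℕP
open import Data.Nat.Combinatorics using (_C_)
open import Data.Nat.DivMod using (_/_)
open import Data.Fin using (Fin; toℕ) renaming (_<_ to _<ᶠ_)
import Data.Fin.Properties as FP
open import Data.Vec using (Vec; []; _∷_; lookup)
open import Data.List using (List; [_]; concatMap; map; filter; length; allFin)
open import Data.Product using (_×_)
open import Relation.Binary.PropositionalEquality using (_≡_)
open import Relation.Nullary using (¬_; Dec)
open import Relation.Nullary.Decidable using (_×-dec_; _→-dec_; ¬?)

catalan : ℕ → ℕ
catalan m = ((2 * m) C m) / suc m

sum1 : ℕ → (ℕ → ℕ) → ℕ
sum1 zero    f = 0
sum1 (suc n) f = sum1 n f + f (suc n)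

-- k-fold Catalan convolution:
-- C_{n,k} = sum over compositions i_1+...+i_k = n (all i_r ≥ 1) of prod_r C_{i_r - 1},
-- computed by recursion on k over the first part i_1 = i.
catConv : ℕ → ℕ → ℕ
catConv zero    zero    = 1
catConv (suc n) zero    = 0
catConv n       (suc k) = sum1 n (λ i → catalan (i ∸ 1) * catConv (n ∸ i) k)

-- A word w = w(1)...w(n) over [n], encoded as a vector of length n with entries in Fin n
-- (0-based values and positions).

IsPerm : ∀ {n} → Vec (Fin n) n → Set
IsPerm {n} w = (i j : Fin n) → lookup w i ≡ lookup w j → i ≡ j

Avoids123 : ∀ {n} → Vec (Fin n) n → Set
Avoids123 {n} w = (a b c : Fin n) → a <ᶠ b → b <ᶠ c →
  ¬ (lookup w a <ᶠ lookup w b × lookup w b <ᶠ lookup w c)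

-- The first ascent of w is in (1-based) position k:
--  * no 1-based position j < k is an ascent, and
--  * if k < n, then position k is an ascent.
-- (0-based positions a, b = a+1 correspond to 1-based positions toℕ a + 1, toℕ b + 1;
--  1-based position j = toℕ a + 1 = toℕ b.)  For k = n this says w has no ascent.
FirstAscentAt : ∀ {n} → Vec (Fin n) n → ℕ → Set
FirstAscentAt {n} w k =
  ((a b : Fin n) → suc (toℕ a) ≡ toℕ b → toℕ b < k → ¬ (lookup w a <ᶠ lookup w b))
  × ((a b : Fin n) → suc (toℕ a) ≡ toℕ b → toℕ b ≡ k → lookup w a <ᶠ lookup w b)

isPerm? : ∀ {n} (w : Vec (Fin n) n) → Dec (IsPerm w)
isPerm? w = FP.all? λ i → FP.all? λ j → FP._≟_ (lookup w i) (lookup w j) →-dec FP._≟_ i j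

avoids123? : ∀ {n} (w : Vec (Fin n) n) → Dec (Avoids123 w)
avoids123? w = FP.all? λ a → FP.all? λ b → FP.all? λ c →
  FP._<?_ a b →-dec (FP._<?_ b c →-dec
    ¬? (FP._<?_ (lookup w a) (lookup w b) ×-dec FP._<?_ (lookup w b) (lookup w c)))

firstAscentAt? : ∀ {n} (w : Vec (Fin n) n) (k : ℕ) → Dec (FirstAscentAt w k)
firstAscentAt? w k =
  (FP.all? λ a → FP.all? λ b →
     ℕP._≟_ (suc (toℕ a)) (toℕ b) →-dec (ℕP._<?_ (toℕ b) k →-dec ¬? (FP._<?_ (lookup w a) (lookup w b))))
  ×-dec
  (FP.all? λ a → FP.all? λ b →
     ℕP._≟_ (suc (toℕ a)) (toℕ b) →-dec (ℕP._≟_ (toℕ b) k →-dec FP._<?_ (lookup w a) (lookup w b)))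

allWords : (m l : ℕ) → List (Vec (Fin m) l)
allWords m zero    = [ [] ]
allWords m (suc l) = concatMap (λ x → map (x ∷_) (allWords m l)) (allFin m)

count123FirstAscent : ℕ → ℕ → ℕ
count123FirstAscent n k =
  length (filter (λ w → isPerm? w ×-dec avoids123? w ×-dec firstAscentAt? w k) (allWords n n))

module Submission where

-- Let B(m, s) be the number of 123-avoiding permutations of {0, …, m-1} whose entries ≥ s
-- occur in decreasing order.  Removing the first entry x and standardising the rest shows
-- B(m+1, s) = Σ_{x < min(s, m+1)} B(m, x) + [s ≤ m] B(m, s): the entries after x that exceed x
-- must decrease, and an entry x ≥ s can only be the maximum.  Recording in addition the
-- initial descending run, the permutations of [m+1] with first ascent at position j+1 are
-- counted by B(m, m - j).  B obeys Pascal's rule, whence the reflection formula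
-- B(m, s) = C(m+s, s) - C(m+s, m+1) and the closed form.  Finally the Catalan convolution
-- satisfies C_{n+1,k+1} = C_{n,k} + C_{n+1,k+2}, and so does C_{n+1,k+1} := B(n, n-k).

open import Defs
open import Data.Nat
open import Data.Nat.Properties
open import Data.Nat.Combinatorics using (_C_; nCk+nC[k+1]≡[n+1]C[k+1]; nCk≡nC[n∸k]; k>n⇒nCk≡0; nC1≡n)
open import Data.Nat.DivMod using (_/_; m*n/n≡m)
open import Data.Nat.Tactic.RingSolver using (solve-∀)
open import Data.Empty using (⊥-elim)
open import Data.Sum using (inj₁; inj₂)
open import Relation.Binary.Definitions using (tri<; tri≈; tri>)
open import Relation.Nullary using (Dec; yes; no; ¬_)
open import Relation.Binary.PropositionalEquality
open import Data.Fin as Fin using (Fin; toℕ; punchIn) renaming (_<_ to _<ᶠ_)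
import Data.Fin.Properties as Finₚ
open import Data.Vec using (Vec; []; _∷_; lookup; map)
import Data.Vec.Properties as Vecₚ
open import Data.List as List using (List; length; filter; concatMap; tabulate)
import Data.List.Properties as Listₚ
open import Data.List.Relation.Unary.All using (universal)
open import Data.Product using (_×_; _,_; proj₁; proj₂; curry)
open import Data.Unit using (⊤; tt)
open import Data.Bool using (true; false)
open import Function using (_∘_; _⇔_; mk⇔; Equivalence)
open import Function.Construct.Composition using (_⇔-∘_)
open import Data.Product.Function.NonDependent.Propositional using (_×-⇔_)
open import Level using (0ℓ)
open import Relation.Unary using (Pred; Decidable)
open import Relation.Nullary.Decidable using (does; _×-dec_; _→-dec_; ¬?)
open import Algebra.Properties.CommutativeMonoid.Sum +-0-commutativeMonoid using (sum; sum-remove; sum-cong-≗)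
open import Algebra.Properties.CommutativeSemigroup +-commutativeSemigroup using (interchange)
open import Algebra.Properties.CommutativeSemigroup *-commutativeSemigroup using (x∙yz≈y∙xz)

open ≡-Reasoning

when : ∀ {p} {P : Set p} → Dec P → ℕ → ℕ
when (yes _) a = a
when (no _)  _ = 0

module _ {p} {P : Set p} where

  when-yes : ∀ (d : Dec P) {a} → P → when d a ≡ a
  when-yes (yes _) _ = refl
  when-yes (no ¬p) p = ⊥-elim (¬p p)

  when-no : ∀ (d : Dec P) {a} → ¬ P → when d a ≡ 0
  when-no (yes p) ¬p = ⊥-elim (¬p p)
  when-no (no _)  _  = refl

∑< : ℕ → (ℕ → ℕ) → ℕ
∑< zero    f = 0
∑< (suc n) f = ∑< n f + f n

∑<-cong : ∀ n {f g} → (∀ x → x < n → f x ≡ g x) → ∑< n f ≡ ∑< n g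
∑<-cong zero    eq = refl
∑<-cong (suc n) eq = cong₂ _+_ (∑<-cong n λ x x<n → eq x (m<n⇒m<1+n x<n)) (eq n ≤-refl)

∑<-zero : ∀ n {f} → (∀ x → x < n → f x ≡ 0) → ∑< n f ≡ 0
∑<-zero zero    eq = refl
∑<-zero (suc n) eq = cong₂ _+_ (∑<-zero n λ x x<n → eq x (m<n⇒m<1+n x<n)) (eq n ≤-refl)

∑<-distrib-+ : ∀ n f g → ∑< n (λ x → f x + g x) ≡ ∑< n f + ∑< n g
∑<-distrib-+ zero    f g = refl
∑<-distrib-+ (suc n) f g =
  trans (cong (_+ (f n + g n)) (∑<-distrib-+ n f g)) (interchange (∑< n f) (∑< n g) (f n) (g n))

∑<-suc : ∀ n g → ∑< (suc n) g ≡ g 0 + ∑< n (λ x → g (suc x))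
∑<-suc zero    g = +-comm 0 (g 0)
∑<-suc (suc n) g = trans (cong (_+ g (suc n)) (∑<-suc n g)) (+-assoc (g 0) _ _)

∑<-when-< : ∀ n s g → ∑< n (λ x → when (x <? s) (g x)) ≡ ∑< (s ⊓ n) g
∑<-when-< zero    s g = cong (λ t → ∑< t g) (sym (⊓-zeroʳ s))
∑<-when-< (suc n) s g with n <? s
... | yes n<s = begin
  ∑< n (λ x → when (x <? s) (g x)) + g n  ≡⟨ cong (_+ g n) (∑<-when-< n s g) ⟩
  ∑< (s ⊓ n) g + g n                      ≡⟨ cong (λ t → ∑< t g + g n) (m≥n⇒m⊓n≡n (<⇒≤ n<s)) ⟩
  ∑< (suc n) g                            ≡⟨ cong (λ t → ∑< t g) (m≥n⇒m⊓n≡n n<s) ⟨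
  ∑< (s ⊓ suc n) g                        ∎
... | no n≮s = begin
  ∑< n (λ x → when (x <? s) (g x)) + 0  ≡⟨ +-identityʳ _ ⟩
  ∑< n (λ x → when (x <? s) (g x))      ≡⟨ ∑<-when-< n s g ⟩
  ∑< (s ⊓ n) g                          ≡⟨ cong (λ t → ∑< t g) (m≤n⇒m⊓n≡m (≮⇒≥ n≮s)) ⟩
  ∑< s g                                ≡⟨ cong (λ t → ∑< t g) (m≤n⇒m⊓n≡m (m≤n⇒m≤1+n (≮⇒≥ n≮s))) ⟨
  ∑< (s ⊓ suc n) g                      ∎

∑<-point : ∀ m c → ∑< (suc m) (λ x → when (x ≟ m) c) ≡ c
∑<-point m c = cong₂ _+_ (∑<-zero m λ x x<m → when-no (x ≟ m) (<⇒≢ x<m)) (when-yes (m ≟ m) refl)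

∑<-shift : ∀ s c g → ∑< s (λ x → when (c ≤? x) (g (x ∸ c))) ≡ ∑< (s ∸ c) g
∑<-shift zero    c g = cong (λ t → ∑< t g) (sym (0∸n≡0 c))
∑<-shift (suc s) c g with c ≤? s
... | yes c≤s rewrite +-∸-assoc 1 c≤s = cong (_+ g (s ∸ c)) (∑<-shift s c g)
... | no c≰s  rewrite m≤n⇒m∸n≡0 (≰⇒> c≰s) =
  trans (+-identityʳ _) (trans (∑<-shift s c g) (cong (λ t → ∑< t g) (m≤n⇒m∸n≡0 (<⇒≤ (≰⇒> c≰s)))))

C-pascal : ∀ n k → suc n C suc k ≡ n C k + n C suc k
C-pascal n k = sym (nCk+nC[k+1]≡[n+1]C[k+1] n k)

C-absorb : ∀ n k → suc k * (suc n C suc k) ≡ suc n * (n C k)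
C-absorb n       zero     = trans (*-identityˡ _) (trans (nC1≡n (suc n)) (sym (*-identityʳ (suc n))))
C-absorb zero    (suc k)  = *-zeroʳ (suc (suc k))
C-absorb (suc n) (suc k) = begin
  suc (suc k) * (suc (suc n) C suc (suc k))
    ≡⟨ cong (suc (suc k) *_) (C-pascal (suc n) (suc k)) ⟩
  suc (suc k) * (suc n C suc k + suc n C suc (suc k))
    ≡⟨ *-distribˡ-+ (suc (suc k)) (suc n C suc k) (suc n C suc (suc k)) ⟩
  (suc n C suc k + suc k * (suc n C suc k)) + suc (suc k) * (suc n C suc (suc k))
    ≡⟨ cong₂ (λ a b → (suc n C suc k + a) + b) (C-absorb n k) (C-absorb n (suc k)) ⟩
  (suc n C suc k + suc n * (n C k)) + suc n * (n C suc k)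
    ≡⟨ +-assoc (suc n C suc k) (suc n * (n C k)) (suc n * (n C suc k)) ⟩
  suc n C suc k + (suc n * (n C k) + suc n * (n C suc k))
    ≡⟨ cong (suc n C suc k +_) (trans (cong (suc n *_) (C-pascal n k)) (*-distribˡ-+ (suc n) (n C k) (n C suc k))) ⟨
  suc (suc n) * (suc n C suc k) ∎

C-ratio : ∀ n k → suc k * (n C suc k) + suc k * (n C k) ≡ suc n * (n C k)
C-ratio n k = begin
  suc k * (n C suc k) + suc k * (n C k)  ≡⟨ +-comm (suc k * (n C suc k)) _ ⟩
  suc k * (n C k) + suc k * (n C suc k)  ≡⟨ *-distribˡ-+ (suc k) (n C k) (n C suc k) ⟨
  suc k * (n C k + n C suc k)            ≡⟨ cong (suc k *_) (C-pascal n k) ⟨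
  suc k * (suc n C suc k)                ≡⟨ C-absorb n k ⟩
  suc n * (n C k)                        ∎

C-symmetric : ∀ m s → (m + s) C m ≡ (m + s) C s
C-symmetric m s = trans (nCk≡nC[n∸k] (m≤m+n m s)) (cong ((m + s) C_) (m+n∸m≡n m s))

ballot : ℕ → ℕ → ℕ
ballot zero    s = 1
ballot (suc m) s = ∑< (s ⊓ suc m) (ballot m) + when (s ≤? m) (ballot m s)

ballot-zeroʳ : ∀ m → ballot m 0 ≡ 1
ballot-zeroʳ zero    = refl
ballot-zeroʳ (suc m) = ballot-zeroʳ m

ballot-∑ : ∀ {m s} → s ≤ m → ballot (suc m) s ≡ ∑< (suc s) (ballot m)
ballot-∑ {m} {s} s≤m =
  cong₂ _+_ (cong (λ t → ∑< t (ballot m)) (m≤n⇒m⊓n≡m (m≤n⇒m≤1+n s≤m))) (when-yes (s ≤? m) s≤m)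

ballot-∑-top : ∀ m → ballot (suc m) (suc m) ≡ ∑< (suc m) (ballot m)
ballot-∑-top m =
  trans (cong₂ _+_ (cong (λ t → ∑< t (ballot m)) (⊓-idem (suc m))) (when-no (suc m ≤? m) (n≮n m)))
        (+-identityʳ _)

ballot-pascal : ∀ {m s} → suc s ≤ m → ballot (suc m) (suc s) ≡ ballot (suc m) s + ballot m (suc s)
ballot-pascal {m} {s} s<m = trans (ballot-∑ s<m) (cong (_+ ballot m (suc s)) (sym (ballot-∑ (<⇒≤ s<m))))

ballot-diagonal : ∀ m → ballot (suc m) (suc m) ≡ ballot (suc m) m
ballot-diagonal m = trans (ballot-∑-top m) (sym (ballot-∑ (≤-refl {m})))

-- The reflection principle, with C(m+s, m+1) = C(m+s, s-1) avoiding the case s = 0.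
ballot+C≡C : ∀ m s → s ≤ m → ballot m s + (m + s) C suc m ≡ (m + s) C s
ballot+C≡C m zero _ = cong₂ _+_ (ballot-zeroʳ m) (k>n⇒nCk≡0 (≤-reflexive (cong suc (+-identityʳ m))))
ballot+C≡C (suc m) (suc t) (s≤s t≤m) with m≤n⇒m<n∨m≡n t≤m
... | inj₁ t<m = begin
  ballot (suc m) (suc t) + suc M C suc (suc m)
    ≡⟨ cong₂ _+_ (ballot-pascal t<m) (trans (C-pascal M (suc m)) (+-comm (M C suc m) (M C suc (suc m)))) ⟩
  (ballot (suc m) t + ballot m (suc t)) + (M C suc (suc m) + M C suc m)
    ≡⟨ interchange (ballot (suc m) t) (ballot m (suc t)) (M C suc (suc m)) (M C suc m) ⟩
  (ballot (suc m) t + M C suc (suc m)) + (ballot m (suc t) + M C suc m)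
    ≡⟨ cong₂ _+_ shorter (ballot+C≡C m (suc t) t<m) ⟩
  M C t + M C suc t
    ≡⟨ C-pascal M t ⟨
  suc M C suc t ∎
  where
  M = m + suc t
  shorter : ballot (suc m) t + M C suc (suc m) ≡ M C t
  shorter = subst (λ n → ballot (suc m) t + n C suc (suc m) ≡ n C t) (sym (+-suc m t))
                  (ballot+C≡C (suc m) t (m≤n⇒m≤1+n t≤m))
... | inj₂ refl = begin
  ballot (suc t) (suc t) + suc M C suc (suc t)
    ≡⟨ cong₂ _+_ (ballot-diagonal t) (C-pascal M (suc t)) ⟩
  ballot (suc t) t + (M C suc t + M C suc (suc t))
    ≡⟨ cong (ballot (suc t) t +_) (+-comm (M C suc t) (M C suc (suc t))) ⟩
  ballot (suc t) t + (M C suc (suc t) + M C suc t)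
    ≡⟨ +-assoc (ballot (suc t) t) (M C suc (suc t)) (M C suc t) ⟨
  (ballot (suc t) t + M C suc (suc t)) + M C suc t
    ≡⟨ cong (_+ M C suc t) shorter ⟩
  M C t + M C suc t
    ≡⟨ C-pascal M t ⟨
  suc M C suc t ∎
  where
  M = t + suc t
  shorter : ballot (suc t) t + M C suc (suc t) ≡ M C t
  shorter = subst (λ n → ballot (suc t) t + n C suc (suc t) ≡ n C t) (sym (+-suc t t))
                  (ballot+C≡C (suc t) t (n≤1+n t))

ballot-closed : ∀ j s → suc (j + s) * ballot (j + s) s ≡ suc j * ((j + s + s) C s)
ballot-closed j s = +-cancelʳ-≡ (suc m * X) _ _ (begin
  suc m * B + suc m * X  ≡⟨ *-distribˡ-+ (suc m) B X ⟨
  suc m * (B + X)        ≡⟨ cong (suc m *_) (ballot+C≡C m s (m≤n+m s j)) ⟩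
  (suc j + s) * Y        ≡⟨ *-distribʳ-+ Y (suc j) s ⟩
  suc j * Y + s * Y      ≡⟨ cong (suc j * Y +_) (sym mX≡sY) ⟩
  suc j * Y + suc m * X  ∎)
  where
  m = j + s
  N = m + s
  B = ballot m s
  X = N C suc m
  Y = N C s
  mX≡sY : suc m * X ≡ s * Y
  mX≡sY = +-cancelʳ-≡ (suc m * Y) _ _ (begin
    suc m * X + suc m * Y  ≡⟨ cong (λ c → suc m * X + suc m * c) (C-symmetric m s) ⟨
    suc m * X + suc m * (N C m)  ≡⟨ C-ratio N m ⟩
    suc N * (N C m)        ≡⟨ cong (suc N *_) (C-symmetric m s) ⟩
    (suc m + s) * Y        ≡⟨ *-distribʳ-+ Y (suc m) s ⟩
    suc m * Y + s * Y      ≡⟨ +-comm (suc m * Y) (s * Y) ⟩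
    s * Y + suc m * Y      ∎)

catalan≡ballot : ∀ m → catalan m ≡ ballot m m
catalan≡ballot m = begin
  ((2 * m) C m) / suc m         ≡⟨ cong (λ n → (n C m) / suc m) (cong (m +_) (+-identityʳ m)) ⟩
  ((m + m) C m) / suc m         ≡⟨ cong (_/ suc m) (trans (sym (trans (ballot-closed 0 m) (*-identityˡ _))) (*-comm (suc m) _)) ⟩
  ballot m m * suc m / suc m    ≡⟨ m*n/n≡m (ballot m m) (suc m) ⟩
  ballot m m                    ∎

ballot-ratio : ∀ j s → suc (j + s + s) * ballot (j + s) s ≡ suc j * (suc (j + s + s) C suc (j + s))
ballot-ratio j s = *-cancelˡ-≡ _ _ (suc m) (begin
  suc m * (suc N * ballot m s)   ≡⟨ x∙yz≈y∙xz (suc m) (suc N) _ ⟩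
  suc N * (suc m * ballot m s)   ≡⟨ cong (suc N *_) (ballot-closed j s) ⟩
  suc N * (suc j * (N C s))      ≡⟨ x∙yz≈y∙xz (suc N) (suc j) _ ⟩
  suc j * (suc N * (N C s))      ≡⟨ cong (λ c → suc j * (suc N * c)) (C-symmetric m s) ⟨
  suc j * (suc N * (N C m))      ≡⟨ cong (suc j *_) (C-absorb N m) ⟨
  suc j * (suc m * (suc N C suc m)) ≡⟨ x∙yz≈y∙xz (suc j) (suc m) _ ⟩
  suc m * (suc j * (suc N C suc m)) ∎)
  where
  m = j + s
  N = m + s

catalanTriangle : ℕ → ℕ → ℕ
catalanTriangle zero    zero    = 1
catalanTriangle zero    (suc k) = 0
catalanTriangle (suc n) zero    = 0
catalanTriangle (suc n) (suc k) = when (k ≤? n) (ballot n (n ∸ k))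

catalanTriangle-vanish : ∀ {n k} → n < k → catalanTriangle n k ≡ 0
catalanTriangle-vanish {zero}  {suc k} _         = refl
catalanTriangle-vanish {suc n} {suc k} (s≤s n<k) = when-no (k ≤? n) (<⇒≱ n<k)

catalanTriangle-step : ∀ n k →
  catalanTriangle (suc n) (suc k) ≡ catalanTriangle n k + catalanTriangle (suc n) (suc (suc k))
catalanTriangle-step zero    zero    = refl
catalanTriangle-step zero    (suc k) = refl
catalanTriangle-step (suc n) zero    = ballot-diagonal n
catalanTriangle-step (suc n) (suc k) with <-cmp k n
... | tri< k<n _ _ = begin
  when (suc k ≤? suc n) (ballot (suc n) (n ∸ k))
    ≡⟨ when-yes (suc k ≤? suc n) (s≤s (<⇒≤ k<n)) ⟩
  ballot (suc n) (n ∸ k)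
    ≡⟨ cong (ballot (suc n)) n∸k≡1+n∸1+k ⟩
  ballot (suc n) (suc (n ∸ suc k))
    ≡⟨ ballot-pascal (subst (_≤ n) n∸k≡1+n∸1+k (m∸n≤m n k)) ⟩
  ballot (suc n) (n ∸ suc k) + ballot n (suc (n ∸ suc k))
    ≡⟨ +-comm (ballot (suc n) (n ∸ suc k)) _ ⟩
  ballot n (suc (n ∸ suc k)) + ballot (suc n) (n ∸ suc k)
    ≡⟨ cong₂ _+_ (trans (cong (ballot n) (sym n∸k≡1+n∸1+k)) (sym (when-yes (k ≤? n) (<⇒≤ k<n))))
                 (sym (when-yes (suc (suc k) ≤? suc n) (s≤s k<n))) ⟩
  when (k ≤? n) (ballot n (n ∸ k)) + when (suc (suc k) ≤? suc n) (ballot (suc n) (n ∸ suc k)) ∎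
  where
  n∸k≡1+n∸1+k : n ∸ k ≡ suc (n ∸ suc k)
  n∸k≡1+n∸1+k = +-∸-assoc 1 k<n
... | tri≈ _ refl _ =
  trans (when-yes (suc k ≤? suc k) ≤-refl) (trans (ballot-at-0 (suc k))
    (sym (cong₂ _+_ (trans (when-yes (k ≤? k) ≤-refl) (ballot-at-0 k))
                    (when-no (suc (suc k) ≤? suc k) (λ p → n≮n k (≤-pred p))))))
  where
  ballot-at-0 : ∀ m → ballot m (k ∸ k) ≡ 1
  ballot-at-0 m = trans (cong (ballot m) (n∸n≡0 k)) (ballot-zeroʳ m)
... | tri> _ _ n<k = trans (when-no (suc k ≤? suc n) (λ p → <⇒≱ n<k (≤-pred p)))
  (sym (cong₂ _+_ (when-no (k ≤? n) (<⇒≱ n<k)) (when-no (suc (suc k) ≤? suc n) λ p → <⇒≱ n<k (<⇒≤ (≤-pred p)))))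

sum1≡∑< : ∀ n f → sum1 n f ≡ ∑< n (λ i → f (suc i))
sum1≡∑< zero    f = refl
sum1≡∑< (suc n) f = cong (_+ f (suc n)) (sum1≡∑< n f)

catalan∗ : ℕ → ℕ → ℕ
catalan∗ n k = ∑< n (λ i → catalan i * catalanTriangle (n ∸ suc i) k)

catalan∗-step : ∀ n k → catalan∗ (suc n) (suc k) ≡ catalan∗ n k + catalan∗ (suc n) (suc (suc k))
catalan∗-step n k = begin
  ∑< n (λ i → c i * T (n ∸ i) (suc k)) + c n * T (n ∸ n) (suc k)
    ≡⟨ cong₂ _+_ (∑<-cong n λ i i<n → split i i<n) (last-vanishes k) ⟩
  ∑< n (λ i → c i * T (n ∸ suc i) k + c i * T (n ∸ i) (suc (suc k))) + 0
    ≡⟨ trans (+-identityʳ _) (∑<-distrib-+ n _ _) ⟩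
  catalan∗ n k + ∑< n (λ i → c i * T (n ∸ i) (suc (suc k)))
    ≡⟨ cong (catalan∗ n k +_) (trans (cong (∑< n (λ i → c i * T (n ∸ i) (suc (suc k))) +_) (last-vanishes (suc k))) (+-identityʳ _)) ⟨
  catalan∗ n k + catalan∗ (suc n) (suc (suc k)) ∎
  where
  c = catalan
  T = catalanTriangle
  split : ∀ i → i < n → c i * T (n ∸ i) (suc k) ≡ c i * T (n ∸ suc i) k + c i * T (n ∸ i) (suc (suc k))
  split i i<n = begin
    c i * T (n ∸ i) (suc k)               ≡⟨ cong (λ m → c i * T m (suc k)) (+-∸-assoc 1 i<n) ⟩
    c i * T (suc (n ∸ suc i)) (suc k)     ≡⟨ cong (c i *_) (catalanTriangle-step (n ∸ suc i) k) ⟩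
    c i * (T (n ∸ suc i) k + T (suc (n ∸ suc i)) (suc (suc k)))
      ≡⟨ *-distribˡ-+ (c i) _ _ ⟩
    c i * T (n ∸ suc i) k + c i * T (suc (n ∸ suc i)) (suc (suc k))
      ≡⟨ cong (λ m → c i * T (n ∸ suc i) k + c i * T m (suc (suc k))) (+-∸-assoc 1 i<n) ⟨
    c i * T (n ∸ suc i) k + c i * T (n ∸ i) (suc (suc k)) ∎
  last-vanishes : ∀ k → c n * T (n ∸ n) (suc k) ≡ 0
  last-vanishes k = trans (cong (λ m → c n * T m (suc k)) (n∸n≡0 n)) (*-zeroʳ (c n))

catalan∗-zero : ∀ n → catalan∗ (suc n) 0 ≡ catalanTriangle (suc n) 1
catalan∗-zero n = cong₂ _+_
  (∑<-zero n λ i i<n → trans (cong (λ m → catalan i * catalanTriangle m 0) (+-∸-assoc 1 i<n)) (*-zeroʳ (catalan i)))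
  (trans (cong (λ m → catalan n * catalanTriangle m 0) (n∸n≡0 n)) (trans (*-identityʳ (catalan n)) (catalan≡ballot n)))

catalan∗-vanish : ∀ {n k} → n < k → catalan∗ (suc n) k ≡ 0
catalan∗-vanish {n} {k} n<k =
  ∑<-zero (suc n) λ i _ → trans (cong (catalan i *_) (catalanTriangle-vanish (≤-<-trans (m∸n≤m n i) n<k)))
                          (*-zeroʳ (catalan i))

-- Both sides satisfy the recursion of catalanTriangle-step; induct on n, and downwards on k from k = n.
catalan∗≡catalanTriangle : ∀ n k → catalan∗ n k ≡ catalanTriangle n (suc k)
catalan∗≡catalanTriangle zero    k = refl
catalan∗≡catalanTriangle (suc n) k = downward (suc n) k (m≤n+m (suc n) k)
  where
  downward : ∀ e k → suc n ≤ k + e → catalan∗ (suc n) k ≡ catalanTriangle (suc n) (suc k)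
  downward zero    k         n<k = trans (catalan∗-vanish n<k′) (sym (catalanTriangle-vanish (s≤s n<k′)))
    where n<k′ = subst (suc n ≤_) (+-identityʳ k) n<k
  downward (suc e) zero      _   = catalan∗-zero n
  downward (suc e) (suc k)   le  = begin
    catalan∗ (suc n) (suc k)                                ≡⟨ catalan∗-step n k ⟩
    catalan∗ n k + catalan∗ (suc n) (suc (suc k))           ≡⟨ cong₂ _+_ (catalan∗≡catalanTriangle n k)
                                                                 (downward e (suc (suc k)) (subst (suc n ≤_) (+-suc (suc k) e) le)) ⟩
    catalanTriangle n (suc k) + catalanTriangle (suc n) (suc (suc (suc k)))
                                                            ≡⟨ catalanTriangle-step n (suc k) ⟨
    catalanTriangle (suc n) (suc (suc k))                   ∎

catConv≡catalanTriangle : ∀ n k → catConv n k ≡ catalanTriangle n k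
catConv≡catalanTriangle zero    zero    = refl
catConv≡catalanTriangle (suc n) zero    = refl
catConv≡catalanTriangle zero    (suc k) = refl
catConv≡catalanTriangle (suc n) (suc k) = begin
  catConv (suc n) (suc k)
    ≡⟨ sum1≡∑< (suc n) _ ⟩
  ∑< (suc n) (λ i → catalan i * catConv (n ∸ i) k)
    ≡⟨ ∑<-cong (suc n) (λ i _ → cong (catalan i *_) (catConv≡catalanTriangle (n ∸ i) k)) ⟩
  catalan∗ (suc n) k
    ≡⟨ catalan∗≡catalanTriangle (suc n) k ⟩
  catalanTriangle (suc n) (suc k) ∎

catConv≡ballot : ∀ j s → catConv (suc (j + s)) (suc j) ≡ ballot (j + s) s
catConv≡ballot j s = begin
  catConv (suc (j + s)) (suc j)          ≡⟨ catConv≡catalanTriangle (suc (j + s)) (suc j) ⟩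
  when (j ≤? j + s) (ballot (j + s) (j + s ∸ j)) ≡⟨ when-yes (j ≤? j + s) (m≤m+n j s) ⟩
  ballot (j + s) (j + s ∸ j)            ≡⟨ cong (ballot (j + s)) (m+n∸m≡n j s) ⟩
  ballot (j + s) s                      ∎

module _ {A : Set} {P : Pred A 0ℓ} (P? : Decidable P) where

  length-filter-map : ∀ {B : Set} (f : B → A) xs → length (filter P? (List.map f xs)) ≡ length (filter (P? ∘ f) xs)
  length-filter-map f List.[]       = refl
  length-filter-map f (x List.∷ xs) with does (P? (f x))
  ... | true  = cong suc (length-filter-map f xs)
  ... | false = length-filter-map f xs

  length-filter-concatMap : ∀ {B : Set} (g : B → List A) {n} (h : Fin n → B) →
    length (filter P? (concatMap g (tabulate h))) ≡ sum (λ i → length (filter P? (g (h i))))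
  length-filter-concatMap g {zero}  h = refl
  length-filter-concatMap g {suc n} h = begin
    length (filter P? (g (h Fin.zero) List.++ concatMap g (tabulate (h ∘ Fin.suc))))
      ≡⟨ cong length (Listₚ.filter-++ P? (g (h Fin.zero)) _) ⟩
    length (filter P? (g (h Fin.zero)) List.++ filter P? (concatMap g (tabulate (h ∘ Fin.suc))))
      ≡⟨ Listₚ.length-++ (filter P? (g (h Fin.zero))) ⟩
    length (filter P? (g (h Fin.zero))) + length (filter P? (concatMap g (tabulate (h ∘ Fin.suc))))
      ≡⟨ cong (_ +_) (length-filter-concatMap g (h ∘ Fin.suc)) ⟩
    sum (λ i → length (filter P? (g (h i)))) ∎

countWords : ∀ a l {P : Pred (Vec (Fin a) l) 0ℓ} → Decidable P → ℕ
countWords a l P? = length (filter P? (allWords a l))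

module _ {a l} {P Q : Pred (Vec (Fin a) l) 0ℓ} (P? : Decidable P) (Q? : Decidable Q) where

  countWords-⇔ : (∀ w → P w ⇔ Q w) → countWords a l P? ≡ countWords a l Q?
  countWords-⇔ P⇔Q =
    cong length (Listₚ.filter-≐ P? Q? ((λ {w} → Equivalence.to (P⇔Q w)) , (λ {w} → Equivalence.from (P⇔Q w))) (allWords a l))

module _ {a l} {P : Pred (Vec (Fin a) l) 0ℓ} (P? : Decidable P) where

  countWords-none : (∀ w → ¬ P w) → countWords a l P? ≡ 0
  countWords-none ¬P = cong length (Listₚ.filter-none P? (universal ¬P (allWords a l)))

countWords-[] : ∀ a {P : Pred (Vec (Fin a) 0) 0ℓ} (P? : Decidable P) → P [] → countWords a 0 P? ≡ 1
countWords-[] a P? p = cong length (Listₚ.filter-accept P? p)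

countWords-∷ : ∀ a l {P : Pred (Vec (Fin a) (suc l)) 0ℓ} (P? : Decidable P) →
  countWords a (suc l) P? ≡ sum (λ x → countWords a l (λ t → P? (x ∷ t)))
countWords-∷ a l P? = trans (length-filter-concatMap P? (λ x → List.map (x ∷_) (allWords a l)) (λ x → x))
  (sum-cong-≗ λ x → length-filter-map P? (x ∷_) (allWords a l))

sum-toℕ : ∀ n (g : ℕ → ℕ) → sum {n} (λ x → g (toℕ x)) ≡ ∑< n g
sum-toℕ zero    g = refl
sum-toℕ (suc n) g = trans (cong (g 0 +_) (sum-toℕ n (λ y → g (suc y)))) (sym (∑<-suc n g))

countWords-by-first : ∀ a l {P : Pred (Vec (Fin a) (suc l)) 0ℓ} (P? : Decidable P) (g : ℕ → ℕ) →
  (∀ x → countWords a l (λ t → P? (x ∷ t)) ≡ g (toℕ x)) → countWords a (suc l) P? ≡ ∑< a g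
countWords-by-first a l P? g first = trans (countWords-∷ a l P?) (trans (sum-cong-≗ first) (sum-toℕ a g))

-- Distinct, Avoids123′ and FirstAscentAt′ extend IsPerm, Avoids123 and FirstAscentAt to words of
-- any length over any alphabet; on Vec (Fin n) n they are the same predicates.
Distinct : ∀ {a l} → Vec (Fin a) l → Set
Distinct {l = l} w = (i j : Fin l) → lookup w i ≡ lookup w j → i ≡ j

Omits : ∀ {a l} → Fin a → Vec (Fin a) l → Set
Omits {l = l} x w = (i : Fin l) → lookup w i ≢ x

distinct? : ∀ {a l} (w : Vec (Fin a) l) → Dec (Distinct w)
distinct? w = Finₚ.all? λ i → Finₚ.all? λ j → Finₚ._≟_ (lookup w i) (lookup w j) →-dec Finₚ._≟_ i j

omits? : ∀ {a l} (x : Fin a) (w : Vec (Fin a) l) → Dec (Omits x w)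
omits? x w = Finₚ.all? λ i → ¬? (Finₚ._≟_ (lookup w i) x)

module _ {a l} (y : Fin a) (t : Vec (Fin a) l) where

  Distinct-∷ : Distinct (y ∷ t) ⇔ (Omits y t × Distinct t)
  Distinct-∷ = mk⇔
    (λ d → (λ i eq → Finₚ.0≢1+n (d Fin.zero (Fin.suc i) (sym eq))) , (λ i j eq → Finₚ.suc-injective (d (Fin.suc i) (Fin.suc j) eq)))
    from
    where
    from : Omits y t × Distinct t → Distinct (y ∷ t)
    from (o , d) Fin.zero    Fin.zero    _  = refl
    from (o , d) Fin.zero    (Fin.suc j) eq = ⊥-elim (o j (sym eq))
    from (o , d) (Fin.suc i) Fin.zero    eq = ⊥-elim (o i eq)
    from (o , d) (Fin.suc i) (Fin.suc j) eq = cong Fin.suc (d i j eq)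

module _ {m l} (x : Fin (suc m)) (t : Vec (Fin m) l) where

  lookup-punchIn : ∀ i → lookup (map (punchIn x) t) i ≡ punchIn x (lookup t i)
  lookup-punchIn i = Vecₚ.lookup-map i (punchIn x) t

  Omits-punchIn : ∀ y → Omits (punchIn x y) (map (punchIn x) t) ⇔ Omits y t
  Omits-punchIn y = mk⇔
    (λ o i eq → o i (trans (lookup-punchIn i) (cong (punchIn x) eq)))
    (λ o i eq → o i (Finₚ.punchIn-injective x _ _ (trans (sym (lookup-punchIn i)) eq)))

Omits-∷ : ∀ {a l} (x y : Fin a) (t : Vec (Fin a) l) → Omits x (y ∷ t) ⇔ (y ≢ x × Omits x t)
Omits-∷ x y t = mk⇔ (λ o → o Fin.zero , o ∘ Fin.suc) from
  where
  from : y ≢ x × Omits x t → Omits x (y ∷ t)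
  from (y≢x , o) Fin.zero    = y≢x
  from (y≢x , o) (Fin.suc i) = o i

-- Deleting the value x from a word that omits it and renumbering the larger values is a bijection.
countWords-omitting : ∀ {m} l (x : Fin (suc m)) {Q : Pred (Vec (Fin (suc m)) l) 0ℓ} (Q? : Decidable Q) →
  countWords (suc m) l (λ w → distinct? w ×-dec (omits? x w ×-dec Q? w))
  ≡ countWords m l (λ w′ → distinct? w′ ×-dec Q? (map (punchIn x) w′))
countWords-omitting {m} zero x {Q} Q? = by-cases (Q? [])
  where
  P? : Decidable (λ w → Distinct w × (Omits x w × Q w))
  P? w = distinct? w ×-dec (omits? x w ×-dec Q? w)
  P′? : Decidable (λ w′ → Distinct w′ × Q (map (punchIn x) w′))
  P′? w′ = distinct? w′ ×-dec Q? (map (punchIn x) w′)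
  by-cases : Dec (Q []) → countWords (suc m) 0 P? ≡ countWords m 0 P′?
  by-cases (yes q) = trans (countWords-[] (suc m) P? ((λ ()) , (λ ()) , q)) (sym (countWords-[] m P′? ((λ ()) , q)))
  by-cases (no ¬q) = trans (countWords-none P? λ { [] p → ¬q (proj₂ (proj₂ p)) })
                     (sym (countWords-none P′? λ { [] p → ¬q (proj₂ p) }))
countWords-omitting {m} (suc l) x {Q} Q? = begin
  countWords (suc m) (suc l) P?
    ≡⟨ countWords-∷ (suc m) l P? ⟩
  sum (λ y → countWords (suc m) l (λ t → P? (y ∷ t)))
    ≡⟨ sum-remove {i = x} (λ y → countWords (suc m) l (λ t → P? (y ∷ t))) ⟩
  countWords (suc m) l (λ t → P? (x ∷ t)) + sum (λ y′ → countWords (suc m) l (λ t → P? (punchIn x y′ ∷ t)))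
    ≡⟨ cong₂ _+_ (countWords-none (λ t → P? (x ∷ t)) λ t p → proj₁ (proj₂ p) Fin.zero refl) (sum-cong-≗ after-first) ⟩
  sum (λ y′ → countWords m l (λ t′ → P′? (y′ ∷ t′)))
    ≡⟨ countWords-∷ m l P′? ⟨
  countWords m (suc l) P′? ∎
  where
  P? : Decidable (λ w → Distinct w × (Omits x w × Q w))
  P? w = distinct? w ×-dec (omits? x w ×-dec Q? w)
  P′? : Decidable (λ w′ → Distinct w′ × Q (map (punchIn x) w′))
  P′? w′ = distinct? w′ ×-dec Q? (map (punchIn x) w′)
  after-first : ∀ y′ → countWords (suc m) l (λ t → P? (punchIn x y′ ∷ t)) ≡ countWords m l (λ t′ → P′? (y′ ∷ t′))
  after-first y′ = begin
    countWords (suc m) l (λ t → P? (y ∷ t))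
      ≡⟨ countWords-⇔ (λ t → P? (y ∷ t)) (λ t → distinct? t ×-dec (omits? x t ×-dec (omits? y t ×-dec Q? (y ∷ t)))) (λ t → mk⇔
           (λ (d , o , q) → let (oy , dt) = Equivalence.to (Distinct-∷ y t) d in dt , proj₂ (Equivalence.to (Omits-∷ x y t) o) , oy , q)
           (λ (dt , ox , oy , q) → Equivalence.from (Distinct-∷ y t) (oy , dt) , Equivalence.from (Omits-∷ x y t) (Finₚ.punchInᵢ≢i x y′ , ox) , q)) ⟩
    countWords (suc m) l (λ t → distinct? t ×-dec (omits? x t ×-dec (omits? y t ×-dec Q? (y ∷ t))))
      ≡⟨ countWords-omitting l x (λ t → omits? y t ×-dec Q? (y ∷ t)) ⟩
    countWords m l (λ t′ → distinct? t′ ×-dec (omits? y (map (punchIn x) t′) ×-dec Q? (y ∷ map (punchIn x) t′)))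
      ≡⟨ countWords-⇔ (λ t′ → distinct? t′ ×-dec (omits? y (map (punchIn x) t′) ×-dec Q? (y ∷ map (punchIn x) t′))) (λ t′ → P′? (y′ ∷ t′)) (λ t′ → mk⇔
           (λ (d , o , q) → Equivalence.from (Distinct-∷ y′ t′) (Equivalence.to (Omits-punchIn x t′ y′) o , d) , q)
           (λ (d , q) → let (o , dt) = Equivalence.to (Distinct-∷ y′ t′) d in dt , Equivalence.from (Omits-punchIn x t′ y′) o , q)) ⟩
    countWords m l (λ t′ → P′? (y′ ∷ t′)) ∎
    where y = punchIn x y′

Distinct⇒¬Omits : ∀ {m} (t : Vec (Fin m) m) → Distinct t → (y : Fin m) → ¬ Omits y t
Distinct⇒¬Omits {suc m} t distinct y omits
  with i , j , i<j , eq ← Finₚ.pigeonhole (n<1+n m) (λ i → Fin.punchOut (omits i ∘ sym))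
  = <-irrefl (cong toℕ (distinct i j (Finₚ.punchOut-injective (omits i ∘ sym) (omits j ∘ sym) eq))) i<j

Avoids123′ : ∀ {a l} → Vec (Fin a) l → Set
Avoids123′ {l = l} w = (i j k : Fin l) → i <ᶠ j → j <ᶠ k →
  ¬ (lookup w i <ᶠ lookup w j × lookup w j <ᶠ lookup w k)

FirstAscentAt′ : ∀ {a l} → Vec (Fin a) l → ℕ → Set
FirstAscentAt′ {l = l} w k =
  ((i j : Fin l) → suc (toℕ i) ≡ toℕ j → toℕ j < k → ¬ (lookup w i <ᶠ lookup w j))
  × ((i j : Fin l) → suc (toℕ i) ≡ toℕ j → toℕ j ≡ k → lookup w i <ᶠ lookup w j)

NoRiseAfter : ∀ {a l} → (Fin a → Set) → Vec (Fin a) l → Set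
NoRiseAfter {l = l} φ w = (i j : Fin l) → i <ᶠ j → φ (lookup w i) → ¬ (lookup w i <ᶠ lookup w j)

DecreasingAbove : ∀ {a l} → ℕ → Vec (Fin a) l → Set
DecreasingAbove s = NoRiseAfter (λ v → s ≤ toℕ v)

Head : ∀ {a l} → (Fin a → Set) → Vec (Fin a) l → Set
Head P []      = ⊤
Head P (v ∷ _) = P v

Avoider : ∀ {a l} → ℕ → Vec (Fin a) l → Set
Avoider s w = Distinct w × (Avoids123′ w × DecreasingAbove s w)

avoids123′? : ∀ {a l} (w : Vec (Fin a) l) → Dec (Avoids123′ w)
avoids123′? w = Finₚ.all? λ i → Finₚ.all? λ j → Finₚ.all? λ k →
  Finₚ._<?_ i j →-dec (Finₚ._<?_ j k →-dec
    ¬? (Finₚ._<?_ (lookup w i) (lookup w j) ×-dec Finₚ._<?_ (lookup w j) (lookup w k)))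

firstAscentAt′? : ∀ {a l} (w : Vec (Fin a) l) k → Dec (FirstAscentAt′ w k)
firstAscentAt′? w k =
  (Finₚ.all? λ i → Finₚ.all? λ j →
     suc (toℕ i) ≟ toℕ j →-dec (toℕ j <? k →-dec ¬? (Finₚ._<?_ (lookup w i) (lookup w j))))
  ×-dec
  (Finₚ.all? λ i → Finₚ.all? λ j →
     suc (toℕ i) ≟ toℕ j →-dec (toℕ j ≟ k →-dec Finₚ._<?_ (lookup w i) (lookup w j)))

decreasingAbove? : ∀ {a l} s (w : Vec (Fin a) l) → Dec (DecreasingAbove s w)
decreasingAbove? s w = Finₚ.all? λ i → Finₚ.all? λ j →
  Finₚ._<?_ i j →-dec (s ≤? toℕ (lookup w i) →-dec ¬? (Finₚ._<?_ (lookup w i) (lookup w j)))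

head? : ∀ {a l} {P : Fin a → Set} → Decidable P → (w : Vec (Fin a) l) → Dec (Head P w)
head? P? []      = yes tt
head? P? (v ∷ _) = P? v

avoider? : ∀ {a l} s (w : Vec (Fin a) l) → Dec (Avoider s w)
avoider? s w = distinct? w ×-dec (avoids123′? w ×-dec decreasingAbove? s w)

module _ {a l} (t : Vec (Fin a) l) where

  NoRiseAfter-mono : ∀ {φ ψ : Fin a → Set} → (∀ v → φ v → ψ v) → NoRiseAfter ψ t → NoRiseAfter φ t
  NoRiseAfter-mono φ⇒ψ nr i j i<j φv = nr i j i<j (φ⇒ψ _ φv)

  NoRiseAfter-⇔ : ∀ {φ ψ : Fin a → Set} → (∀ v → φ v ⇔ ψ v) → NoRiseAfter φ t ⇔ NoRiseAfter ψ t
  NoRiseAfter-⇔ φ⇔ψ = mk⇔ (NoRiseAfter-mono (λ v → Equivalence.from (φ⇔ψ v)))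
                          (NoRiseAfter-mono (λ v → Equivalence.to (φ⇔ψ v)))

  Head-⇔ : ∀ {P Q : Fin a → Set} → (∀ v → P v ⇔ Q v) → Head P t ⇔ Head Q t
  Head-⇔ {P} {Q} P⇔Q = mk⇔ (to t) (from t)
    where
    to : ∀ {l} (t : Vec (Fin a) l) → Head P t → Head Q t
    to []      _ = tt
    to (v ∷ _) p = Equivalence.to (P⇔Q v) p
    from : ∀ {l} (t : Vec (Fin a) l) → Head Q t → Head P t
    from []      _ = tt
    from (v ∷ _) q = Equivalence.from (P⇔Q v) q

module _ {a l} (y : Fin a) (t : Vec (Fin a) l) where

  Avoids123′-∷ : Avoids123′ (y ∷ t) ⇔ (Avoids123′ t × NoRiseAfter (y <ᶠ_) t)
  Avoids123′-∷ = mk⇔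
    (λ av → (λ i j k i<j j<k → av (Fin.suc i) (Fin.suc j) (Fin.suc k) (s≤s i<j) (s≤s j<k))
          , (λ i j i<j y<ti → curry (av Fin.zero (Fin.suc i) (Fin.suc j) (s≤s z≤n) (s≤s i<j)) y<ti))
    from
    where
    from : Avoids123′ t × NoRiseAfter (y <ᶠ_) t → Avoids123′ (y ∷ t)
    from (av , nr) Fin.zero    (Fin.suc j) (Fin.suc k) _         (s≤s j<k) (p , q) = nr j k j<k p q
    from (av , nr) (Fin.suc i) (Fin.suc j) (Fin.suc k) (s≤s i<j) (s≤s j<k) pq      = av i j k i<j j<k pq

  NoRiseAfter-∷ : ∀ {φ : Fin a → Set} →
    NoRiseAfter φ (y ∷ t) ⇔ ((φ y → ∀ i → ¬ y <ᶠ lookup t i) × NoRiseAfter φ t)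
  NoRiseAfter-∷ {φ} = mk⇔
    (λ nr → (λ φy i → nr Fin.zero (Fin.suc i) (s≤s z≤n) φy) , (λ i j i<j → nr (Fin.suc i) (Fin.suc j) (s≤s i<j)))
    from
    where
    from : (φ y → ∀ i → ¬ y <ᶠ lookup t i) × NoRiseAfter φ t → NoRiseAfter φ (y ∷ t)
    from (top , nr) Fin.zero    (Fin.suc j) _         φy = top φy j
    from (top , nr) (Fin.suc i) (Fin.suc j) (s≤s i<j)    = nr i j i<j

module _ {a} (y : Fin a) where

  FirstAscentAt′-∷-1 : ∀ {l} (t : Vec (Fin a) l) → FirstAscentAt′ (y ∷ t) 1 ⇔ Head (y <ᶠ_) t
  FirstAscentAt′-∷-1 {l} t = mk⇔ (to t) (λ hd → no-descent , ascent t hd)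
    where
    to : ∀ {l} (t : Vec (Fin a) l) → FirstAscentAt′ (y ∷ t) 1 → Head (y <ᶠ_) t
    to []      _        = tt
    to (_ ∷ _) (_ , up) = up Fin.zero (Fin.suc Fin.zero) refl refl
    no-descent : (i j : Fin (suc l)) → suc (toℕ i) ≡ toℕ j → toℕ j < 1 → ¬ (lookup (y ∷ t) i <ᶠ lookup (y ∷ t) j)
    no-descent i Fin.zero    ()
    no-descent i (Fin.suc j) _ (s≤s ())
    ascent : ∀ {l} (t : Vec (Fin a) l) → Head (y <ᶠ_) t →
      (i j : Fin (suc l)) → suc (toℕ i) ≡ toℕ j → toℕ j ≡ 1 → lookup (y ∷ t) i <ᶠ lookup (y ∷ t) j
    ascent (_ ∷ _) hd Fin.zero    (Fin.suc Fin.zero)    _  _  = hd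
    ascent (_ ∷ _) hd Fin.zero    (Fin.suc (Fin.suc _)) () _
    ascent (_ ∷ _) hd (Fin.suc _) (Fin.suc Fin.zero)    () _
    ascent (_ ∷ _) hd (Fin.suc _) (Fin.suc (Fin.suc _)) _  ()

  FirstAscentAt′-∷-suc : ∀ {l} (t : Vec (Fin a) l) j →
    FirstAscentAt′ (y ∷ t) (suc (suc j)) ⇔ (Head (λ v → ¬ y <ᶠ v) t × FirstAscentAt′ t (suc j))
  FirstAscentAt′-∷-suc t j = mk⇔ (to t) (λ (hd , down , up) → from-down t hd down , from-up t up)
    where
    to : ∀ {l} (t : Vec (Fin a) l) → FirstAscentAt′ (y ∷ t) (suc (suc j)) → Head (λ v → ¬ y <ᶠ v) t × FirstAscentAt′ t (suc j)
    to []      _           = tt , (λ ()) , (λ ())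
    to (_ ∷ _) (down , up) =
      down Fin.zero (Fin.suc Fin.zero) refl (s≤s (s≤s z≤n))
      , (λ i i′ e lt → down (Fin.suc i) (Fin.suc i′) (cong suc e) (s≤s lt))
      , (λ i i′ e e′ → up (Fin.suc i) (Fin.suc i′) (cong suc e) (cong suc e′))
    from-down : ∀ {l} (t : Vec (Fin a) l) → Head (λ v → ¬ y <ᶠ v) t →
      ((i i′ : Fin l) → suc (toℕ i) ≡ toℕ i′ → toℕ i′ < suc j → ¬ (lookup t i <ᶠ lookup t i′)) →
      (i i′ : Fin (suc l)) → suc (toℕ i) ≡ toℕ i′ → toℕ i′ < suc (suc j) → ¬ (lookup (y ∷ t) i <ᶠ lookup (y ∷ t) i′)
    from-down (_ ∷ _) hd down Fin.zero    (Fin.suc Fin.zero)     _ _  = hd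
    from-down (_ ∷ _) hd down Fin.zero    (Fin.suc (Fin.suc _))  () _
    from-down t       hd down (Fin.suc i) (Fin.suc i′) e (s≤s lt) = down i i′ (suc-injective e) lt
    from-up : ∀ {l} (t : Vec (Fin a) l) →
      ((i i′ : Fin l) → suc (toℕ i) ≡ toℕ i′ → toℕ i′ ≡ suc j → lookup t i <ᶠ lookup t i′) →
      (i i′ : Fin (suc l)) → suc (toℕ i) ≡ toℕ i′ → toℕ i′ ≡ suc (suc j) → lookup (y ∷ t) i <ᶠ lookup (y ∷ t) i′
    from-up (_ ∷ _) up Fin.zero    (Fin.suc Fin.zero)    _  ()
    from-up (_ ∷ _) up Fin.zero    (Fin.suc (Fin.suc _)) () _
    from-up t       up (Fin.suc i) (Fin.suc i′)          e  e′ = up i i′ (suc-injective e) (suc-injective e′)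

punchIn-<-⇔ : ∀ {m} (x : Fin (suc m)) (u v : Fin m) → punchIn x u <ᶠ punchIn x v ⇔ u <ᶠ v
punchIn-<-⇔ x u v = mk⇔
  (λ p → ≰⇒> λ v≤u → <⇒≱ p (Finₚ.punchIn-mono-≤ x v u v≤u))
  (λ u<v → ≰⇒> λ πv≤πu → <⇒≱ u<v (Finₚ.punchIn-cancel-≤ x v u πv≤πu))

punchIn-above-⇔ : ∀ {m} (x : Fin (suc m)) (v : Fin m) → x <ᶠ punchIn x v ⇔ toℕ x ≤ toℕ v
punchIn-above-⇔ Fin.zero    v           = mk⇔ (λ _ → z≤n) (λ _ → s≤s z≤n)
punchIn-above-⇔ (Fin.suc x) Fin.zero    = mk⇔ (λ ()) (λ ())
punchIn-above-⇔ (Fin.suc x) (Fin.suc v) = mk⇔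
  (λ p → s≤s (Equivalence.to (punchIn-above-⇔ x v) (≤-pred p)))
  (λ p → s≤s (Equivalence.from (punchIn-above-⇔ x v) (≤-pred p)))

toℕ-punchIn-below : ∀ {m} (x : Fin (suc m)) (v : Fin m) → toℕ v < toℕ x → toℕ (punchIn x v) ≡ toℕ v
toℕ-punchIn-below (Fin.suc x) Fin.zero    _         = refl
toℕ-punchIn-below (Fin.suc x) (Fin.suc v) (s≤s v<x) = cong suc (toℕ-punchIn-below x v v<x)

module _ {m l} (x : Fin (suc m)) (t : Vec (Fin m) l) where

  private
    π = punchIn x
    <-map-⇔ : ∀ i j → lookup (map π t) i <ᶠ lookup (map π t) j ⇔ lookup t i <ᶠ lookup t j
    <-map-⇔ i j = subst₂ (λ u v → u <ᶠ v ⇔ lookup t i <ᶠ lookup t j)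
      (sym (lookup-punchIn x t i)) (sym (lookup-punchIn x t j)) (punchIn-<-⇔ x (lookup t i) (lookup t j))
    up : ∀ {i j} → lookup t i <ᶠ lookup t j → lookup (map π t) i <ᶠ lookup (map π t) j
    up = Equivalence.from (<-map-⇔ _ _)
    down : ∀ {i j} → lookup (map π t) i <ᶠ lookup (map π t) j → lookup t i <ᶠ lookup t j
    down = Equivalence.to (<-map-⇔ _ _)

  Avoids123′-punchIn : Avoids123′ (map π t) ⇔ Avoids123′ t
  Avoids123′-punchIn = mk⇔
    (λ av i j k i<j j<k (p , q) → av i j k i<j j<k (up p , up q))
    (λ av i j k i<j j<k (p , q) → av i j k i<j j<k (down p , down q))

  NoRiseAfter-punchIn : ∀ {φ : Fin (suc m) → Set} → NoRiseAfter φ (map π t) ⇔ NoRiseAfter (φ ∘ π) t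
  NoRiseAfter-punchIn {φ} = mk⇔
    (λ nr i j i<j φv p → nr i j i<j (subst φ (sym (lookup-punchIn x t i)) φv) (up p))
    (λ nr i j i<j φv p → nr i j i<j (subst φ (lookup-punchIn x t i) φv) (down p))

  FirstAscentAt′-punchIn : ∀ k → FirstAscentAt′ (map π t) k ⇔ FirstAscentAt′ t k
  FirstAscentAt′-punchIn k = mk⇔
    (λ (d , u) → (λ i j e lt p → d i j e lt (up p)) , (λ i j e e′ → down (u i j e e′)))
    (λ (d , u) → (λ i j e lt p → d i j e lt (down p)) , (λ i j e e′ → up (u i j e e′)))

  Head-punchIn : ∀ {P : Fin (suc m) → Set} → Head P (map π t) ⇔ Head (P ∘ π) t
  Head-punchIn {P} = mk⇔ (to t) (from t)
    where
    to : ∀ {l} (t : Vec (Fin m) l) → Head P (map π t) → Head (P ∘ π) t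
    to []      h = h
    to (_ ∷ _) h = h
    from : ∀ {l} (t : Vec (Fin m) l) → Head (P ∘ π) t → Head P (map π t)
    from []      h = h
    from (_ ∷ _) h = h

-- For an avoider x ∷ map (punchIn x) t the letters of t above x must decrease, so the threshold
-- becomes min(s, x); and a first letter x ≥ s has no larger letter after it, so it is the maximum.
module FirstLetter {m} (x : Fin (suc m)) where

  private
    π = punchIn x

    x≮π : toℕ x ≡ m → ∀ v → ¬ x <ᶠ π v
    x≮π x≡m v x<πv = <-asym v<x (subst (toℕ x <_) (toℕ-punchIn-below x v v<x) x<πv)
      where
      v<x : toℕ v < toℕ x
      v<x = subst (toℕ v <_) (sym x≡m) (Finₚ.toℕ<n v)

  first-below : ∀ {s l} → toℕ x < s → (t : Vec (Fin m) l) →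
    (Avoids123′ (x ∷ map π t) × DecreasingAbove s (x ∷ map π t)) ⇔ (Avoids123′ t × DecreasingAbove (toℕ x) t)
  first-below {s} x<s t = mk⇔
    (λ (av , _) → let (av′ , nr) = Equivalence.to (Avoids123′-∷ x (map π t)) av
                  in Equivalence.to (Avoids123′-punchIn x t) av′ , Equivalence.to above-x nr)
    (λ (av , dec) → let nr = Equivalence.from above-x dec in
      Equivalence.from (Avoids123′-∷ x (map π t)) (Equivalence.from (Avoids123′-punchIn x t) av , nr)
      , Equivalence.from (NoRiseAfter-∷ x (map π t) {φ = λ v → s ≤ toℕ v})
          ((λ s≤x → ⊥-elim (<⇒≱ x<s s≤x)) , NoRiseAfter-mono (map π t) (λ v s≤v → <-≤-trans {toℕ x} {s} {toℕ v} x<s s≤v) nr))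
    where
    above-x : NoRiseAfter (x <ᶠ_) (map π t) ⇔ DecreasingAbove (toℕ x) t
    above-x = NoRiseAfter-⇔ t (punchIn-above-⇔ x) ⇔-∘ NoRiseAfter-punchIn x t {φ = x <ᶠ_}

  first-max : ∀ {s l} → toℕ x ≡ m → (t : Vec (Fin m) l) →
    (Avoids123′ (x ∷ map π t) × DecreasingAbove s (x ∷ map π t)) ⇔ (Avoids123′ t × DecreasingAbove s t)
  first-max {s} x≡m t = mk⇔
    (λ (av , dec) → Equivalence.to (Avoids123′-punchIn x t) (proj₁ (Equivalence.to (Avoids123′-∷ x (map π t)) av))
                  , Equivalence.to tail-dec (proj₂ (Equivalence.to (NoRiseAfter-∷ x (map π t) {φ = λ v → s ≤ toℕ v}) dec)))
    (λ (av , dec) →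
      Equivalence.from (Avoids123′-∷ x (map π t)) (Equivalence.from (Avoids123′-punchIn x t) av , λ i _ _ x<ti _ → x≮t i x<ti)
      , Equivalence.from (NoRiseAfter-∷ x (map π t) {φ = λ v → s ≤ toℕ v}) ((λ _ → x≮t) , Equivalence.from tail-dec dec))
    where
    x≮t : ∀ i → ¬ x <ᶠ lookup (map π t) i
    x≮t i = subst (λ u → ¬ x <ᶠ u) (sym (lookup-punchIn x t i)) (x≮π x≡m (lookup t i))
    tail-dec : DecreasingAbove s (map π t) ⇔ DecreasingAbove s t
    tail-dec = NoRiseAfter-⇔ t (λ v → mk⇔ (subst (s ≤_) (below-max v)) (subst (s ≤_) (sym (below-max v))))
               ⇔-∘ NoRiseAfter-punchIn x t {φ = λ v → s ≤ toℕ v}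
      where
      below-max : ∀ v → toℕ (π v) ≡ toℕ v
      below-max v = toℕ-punchIn-below x v (subst (toℕ v <_) (sym x≡m) (Finₚ.toℕ<n v))

  first-middle : ∀ {s} → s ≤ toℕ x → toℕ x ≢ m → (t : Vec (Fin m) m) → Distinct t →
    ¬ (Avoids123′ (x ∷ map π t) × DecreasingAbove s (x ∷ map π t))
  first-middle {s} s≤x x≢m t distinct (_ , dec) = Distinct⇒¬Omits t distinct y omits
    where
    x<m : toℕ x < m
    x<m = ≤∧≢⇒< (≤-pred (Finₚ.toℕ<n x)) x≢m
    y : Fin m
    y = Fin.fromℕ< x<m
    x<πy : x <ᶠ π y
    x<πy = Equivalence.from (punchIn-above-⇔ x y) (≤-reflexive (sym (Finₚ.toℕ-fromℕ< x<m)))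
    omits : Omits y t
    omits i ti≡y = proj₁ (Equivalence.to (NoRiseAfter-∷ x (map π t) {φ = λ v → s ≤ toℕ v}) dec) s≤x i
      (subst (x <ᶠ_) (sym (trans (lookup-punchIn x t i) (cong π ti≡y))) x<πy)

  module _ (s : ℕ) {E : Pred (Vec (Fin (suc m)) (suc m)) 0ℓ} (E? : Decidable E) where

    private
      Rest? : Decidable (λ (t : Vec (Fin m) m) → (Avoids123′ (x ∷ map π t) × DecreasingAbove s (x ∷ map π t)) × E (x ∷ map π t))
      Rest? t = (avoids123′? (x ∷ map π t) ×-dec decreasingAbove? s (x ∷ map π t)) ×-dec E? (x ∷ map π t)

    countWords-first : countWords (suc m) m (λ t → avoider? s (x ∷ t) ×-dec E? (x ∷ t))
                     ≡ countWords m m (λ t → distinct? t ×-dec Rest? t)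
    countWords-first = trans
      (countWords-⇔ (λ t → avoider? s (x ∷ t) ×-dec E? (x ∷ t))
                    (λ t → distinct? t ×-dec (omits? x t ×-dec ((avoids123′? (x ∷ t) ×-dec decreasingAbove? s (x ∷ t)) ×-dec E? (x ∷ t))))
                    λ t → mk⇔ (λ ((d , ad) , e) → let (o , d′) = Equivalence.to (Distinct-∷ x t) d in d′ , o , ad , e)
                              (λ (d′ , o , ad , e) → (Equivalence.from (Distinct-∷ x t) (o , d′) , ad) , e))
      (countWords-omitting m x (λ t → (avoids123′? (x ∷ t) ×-dec decreasingAbove? s (x ∷ t)) ×-dec E? (x ∷ t)))

    countWords-first-below : toℕ x < s → countWords (suc m) m (λ t → avoider? s (x ∷ t) ×-dec E? (x ∷ t))
                           ≡ countWords m m (λ t → avoider? (toℕ x) t ×-dec E? (x ∷ map π t))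
    countWords-first-below x<s = trans countWords-first
      (countWords-⇔ (λ t → distinct? t ×-dec Rest? t) (λ t → avoider? (toℕ x) t ×-dec E? (x ∷ map π t))
        λ t → mk⇔ (λ (d , ad , e) → (d , Equivalence.to (first-below x<s t) ad) , e)
                  (λ ((d , ad) , e) → d , Equivalence.from (first-below x<s t) ad , e))

    countWords-first-max : toℕ x ≡ m → countWords (suc m) m (λ t → avoider? s (x ∷ t) ×-dec E? (x ∷ t))
                         ≡ countWords m m (λ t → avoider? s t ×-dec E? (x ∷ map π t))
    countWords-first-max x≡m = trans countWords-first
      (countWords-⇔ (λ t → distinct? t ×-dec Rest? t) (λ t → avoider? s t ×-dec E? (x ∷ map π t))
        λ t → mk⇔ (λ (d , ad , e) → (d , Equivalence.to (first-max x≡m t) ad) , e)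
                  (λ ((d , ad) , e) → d , Equivalence.from (first-max x≡m t) ad , e))

    countWords-first-middle : s ≤ toℕ x → toℕ x ≢ m → countWords (suc m) m (λ t → avoider? s (x ∷ t) ×-dec E? (x ∷ t)) ≡ 0
    countWords-first-middle s≤x x≢m = trans countWords-first
      (countWords-none (λ t → distinct? t ×-dec Rest? t) λ t (d , ad , _) → first-middle s≤x x≢m t d ad)

#avoiders : ℕ → ℕ → ℕ
#avoiders m s = countWords m m (avoider? s)

#avoiders-headAtLeast : ℕ → ℕ → ℕ
#avoiders-headAtLeast m s = countWords m m (λ w → avoider? s w ×-dec head? (λ v → s ≤? toℕ v) w)

#avoiders-firstAscent : ℕ → ℕ → ℕ → ℕ
#avoiders-firstAscent m s j =
  countWords m m (λ w → avoider? s w ×-dec (head? (λ v → toℕ v <? s) w ×-dec firstAscentAt′? w (suc j)))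

module _ {m} (x : Fin (suc m)) (s : ℕ) where

  open FirstLetter x

  private
    π = punchIn x
    top-vanishes : ∀ c → toℕ x < s → (e : Dec (toℕ x ≡ m)) → when e (when (s ≤? m) c) ≡ 0
    top-vanishes c x<s (yes x≡m) = when-no (s ≤? m) (λ s≤m → <⇒≱ x<s (subst (s ≤_) (sym x≡m) s≤m))
    top-vanishes c x<s (no _)    = refl

  #avoiders-first : countWords (suc m) m (λ t → avoider? s (x ∷ t))
    ≡ when (toℕ x <? s) (#avoiders m (toℕ x)) + when (toℕ x ≟ m) (when (s ≤? m) (#avoiders m s))
  #avoiders-first = trans (countWords-⇔ (λ t → avoider? s (x ∷ t)) (λ t → avoider? s (x ∷ t) ×-dec ⊤? (x ∷ t)) λ _ → mk⇔ (_, tt) proj₁)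
                          (by-cases (toℕ x <? s) (toℕ x ≟ m))
    where
    ⊤? : Decidable {A = Vec (Fin (suc m)) (suc m)} (λ _ → ⊤)
    ⊤? _ = yes tt
    drop⊤ : ∀ r → countWords m m (λ t → avoider? r t ×-dec ⊤? (x ∷ map π t)) ≡ #avoiders m r
    drop⊤ r = countWords-⇔ (λ t → avoider? r t ×-dec ⊤? (x ∷ map π t)) (avoider? r) λ _ → mk⇔ proj₁ (_, tt)
    by-cases : (d : Dec (toℕ x < s)) (e : Dec (toℕ x ≡ m)) →
      countWords (suc m) m (λ t → avoider? s (x ∷ t) ×-dec ⊤? (x ∷ t))
      ≡ when d (#avoiders m (toℕ x)) + when e (when (s ≤? m) (#avoiders m s))
    by-cases (yes x<s) e = trans (countWords-first-below s ⊤? x<s)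
      (trans (drop⊤ (toℕ x)) (sym (trans (cong (_ +_) (top-vanishes _ x<s e)) (+-identityʳ _))))
    by-cases (no x≮s) (yes x≡m) = trans (countWords-first-max s ⊤? x≡m)
      (trans (drop⊤ s) (sym (when-yes (s ≤? m) (subst (s ≤_) x≡m (≮⇒≥ x≮s)))))
    by-cases (no x≮s) (no x≢m) = countWords-first-middle s ⊤? (≮⇒≥ x≮s) x≢m

  #avoiders-headAtLeast-first :
    countWords (suc m) m (λ t → avoider? s (x ∷ t) ×-dec head? (λ v → s ≤? toℕ v) (x ∷ t))
    ≡ when (toℕ x ≟ m) (when (s ≤? m) (#avoiders m s))
  #avoiders-headAtLeast-first = by-cases (s ≤? toℕ x) (toℕ x ≟ m)
    where
    E? : Decidable {A = Vec (Fin (suc m)) (suc m)} (Head (λ v → s ≤ toℕ v))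
    E? = head? (λ v → s ≤? toℕ v)
    by-cases : Dec (s ≤ toℕ x) → (e : Dec (toℕ x ≡ m)) →
      countWords (suc m) m (λ t → avoider? s (x ∷ t) ×-dec E? (x ∷ t)) ≡ when e (when (s ≤? m) (#avoiders m s))
    by-cases (yes s≤x) (yes x≡m) = trans (countWords-first-max s E? x≡m)
      (trans (countWords-⇔ (λ t → avoider? s t ×-dec E? (x ∷ map π t)) (avoider? s) λ _ → mk⇔ proj₁ (_, s≤x))
             (sym (when-yes (s ≤? m) (subst (s ≤_) x≡m s≤x))))
    by-cases (yes s≤x) (no x≢m) = countWords-first-middle s E? s≤x x≢m
    by-cases (no s≰x) e = trans (countWords-none (λ t → avoider? s (x ∷ t) ×-dec E? (x ∷ t)) λ _ p → s≰x (proj₂ p))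
                          (sym (vanishes e))
      where
      vanishes : (e : Dec (toℕ x ≡ m)) → when e (when (s ≤? m) (#avoiders m s)) ≡ 0
      vanishes (yes x≡m) = when-no (s ≤? m) (λ s≤m → s≰x (subst (s ≤_) (sym x≡m) s≤m))
      vanishes (no _)    = refl

  #avoiders-firstAscent-first-zero :
    countWords (suc m) m (λ t → avoider? s (x ∷ t) ×-dec (head? (λ v → toℕ v <? s) (x ∷ t) ×-dec firstAscentAt′? (x ∷ t) 1))
    ≡ when (toℕ x <? s) (#avoiders-headAtLeast m (toℕ x))
  #avoiders-firstAscent-first-zero = by-cases (toℕ x <? s)
    where
    E? : Decidable {A = Vec (Fin (suc m)) (suc m)} (λ w → Head (λ v → toℕ v < s) w × FirstAscentAt′ w 1)
    E? w = head? (λ v → toℕ v <? s) w ×-dec firstAscentAt′? w 1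
    ascent-⇔ : ∀ t → FirstAscentAt′ (x ∷ map π t) 1 ⇔ Head (λ v → toℕ x ≤ toℕ v) t
    ascent-⇔ t = (Head-⇔ t (punchIn-above-⇔ x) ⇔-∘ Head-punchIn x t) ⇔-∘ FirstAscentAt′-∷-1 x (map π t)
    by-cases : (d : Dec (toℕ x < s)) →
      countWords (suc m) m (λ t → avoider? s (x ∷ t) ×-dec E? (x ∷ t)) ≡ when d (#avoiders-headAtLeast m (toℕ x))
    by-cases (yes x<s) = trans (countWords-first-below s E? x<s)
      (countWords-⇔ (λ t → avoider? (toℕ x) t ×-dec E? (x ∷ map π t)) (λ w → avoider? (toℕ x) w ×-dec head? (λ v → toℕ x ≤? toℕ v) w)
        λ t → mk⇔ (λ (a , _ , fa) → a , Equivalence.to (ascent-⇔ t) fa) (λ (a , h) → a , x<s , Equivalence.from (ascent-⇔ t) h))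
    by-cases (no x≮s) = countWords-none (λ t → avoider? s (x ∷ t) ×-dec E? (x ∷ t)) λ _ p → x≮s (proj₁ (proj₂ p))

  #avoiders-firstAscent-first-suc : ∀ j →
    countWords (suc m) m (λ t → avoider? s (x ∷ t) ×-dec (head? (λ v → toℕ v <? s) (x ∷ t) ×-dec firstAscentAt′? (x ∷ t) (suc (suc j))))
    ≡ when (toℕ x <? s) (#avoiders-firstAscent m (toℕ x) j)
  #avoiders-firstAscent-first-suc j = by-cases (toℕ x <? s)
    where
    E? : Decidable {A = Vec (Fin (suc m)) (suc m)} (λ w → Head (λ v → toℕ v < s) w × FirstAscentAt′ w (suc (suc j)))
    E? w = head? (λ v → toℕ v <? s) w ×-dec firstAscentAt′? w (suc (suc j))
    not-above-⇔ : ∀ v → (¬ x <ᶠ π v) ⇔ toℕ v < toℕ x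
    not-above-⇔ v = mk⇔ (λ x≮πv → ≰⇒> (x≮πv ∘ Equivalence.from (punchIn-above-⇔ x v)))
                        (λ v<x x<πv → <⇒≱ v<x (Equivalence.to (punchIn-above-⇔ x v) x<πv))
    ascent-⇔ : ∀ t → FirstAscentAt′ (x ∷ map π t) (suc (suc j)) ⇔ (Head (λ v → toℕ v < toℕ x) t × FirstAscentAt′ t (suc j))
    ascent-⇔ t = ((Head-⇔ t not-above-⇔ ⇔-∘ Head-punchIn x t) ×-⇔ FirstAscentAt′-punchIn x t (suc j))
                 ⇔-∘ FirstAscentAt′-∷-suc x (map π t) j
    by-cases : (d : Dec (toℕ x < s)) →
      countWords (suc m) m (λ t → avoider? s (x ∷ t) ×-dec E? (x ∷ t)) ≡ when d (#avoiders-firstAscent m (toℕ x) j)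
    by-cases (yes x<s) = trans (countWords-first-below s E? x<s)
      (countWords-⇔ (λ t → avoider? (toℕ x) t ×-dec E? (x ∷ map π t))
                    (λ w → avoider? (toℕ x) w ×-dec (head? (λ v → toℕ v <? toℕ x) w ×-dec firstAscentAt′? w (suc j)))
        λ t → mk⇔ (λ (a , _ , fa) → a , Equivalence.to (ascent-⇔ t) fa) (λ (a , h) → a , x<s , Equivalence.from (ascent-⇔ t) h))
    by-cases (no x≮s) = countWords-none (λ t → avoider? s (x ∷ t) ×-dec E? (x ∷ t)) λ _ p → x≮s (proj₁ (proj₂ p))

#avoiders≡ballot : ∀ m s → #avoiders m s ≡ ballot m s
#avoiders≡ballot zero    s = countWords-[] 0 (avoider? s) ((λ ()) , (λ ()) , (λ ()))
#avoiders≡ballot (suc m) s = begin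
  #avoiders (suc m) s
    ≡⟨ countWords-by-first (suc m) m (avoider? s) _ (λ x → #avoiders-first x s) ⟩
  ∑< (suc m) (λ y → when (y <? s) (#avoiders m y) + when (y ≟ m) (when (s ≤? m) (#avoiders m s)))
    ≡⟨ ∑<-distrib-+ (suc m) _ _ ⟩
  ∑< (suc m) (λ y → when (y <? s) (#avoiders m y)) + ∑< (suc m) (λ y → when (y ≟ m) (when (s ≤? m) (#avoiders m s)))
    ≡⟨ cong₂ _+_ (∑<-when-< (suc m) s (#avoiders m)) (∑<-point m _) ⟩
  ∑< (s ⊓ suc m) (#avoiders m) + when (s ≤? m) (#avoiders m s)
    ≡⟨ cong₂ _+_ (∑<-cong (s ⊓ suc m) λ y _ → #avoiders≡ballot m y) (cong (when (s ≤? m)) (#avoiders≡ballot m s)) ⟩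
  ballot (suc m) s ∎

#avoiders-headAtLeast-suc : ∀ m s → #avoiders-headAtLeast (suc m) s ≡ when (s ≤? m) (ballot m s)
#avoiders-headAtLeast-suc m s = begin
  #avoiders-headAtLeast (suc m) s
    ≡⟨ countWords-by-first (suc m) m (λ w → avoider? s w ×-dec head? (λ v → s ≤? toℕ v) w) _
                           (λ x → #avoiders-headAtLeast-first x s) ⟩
  ∑< (suc m) (λ y → when (y ≟ m) (when (s ≤? m) (#avoiders m s)))
    ≡⟨ ∑<-point m _ ⟩
  when (s ≤? m) (#avoiders m s)
    ≡⟨ cong (when (s ≤? m)) (#avoiders≡ballot m s) ⟩
  when (s ≤? m) (ballot m s) ∎

#avoiders-headAtLeast-∑ : ∀ {m r} → r ≤ m → ∑< (suc r) (#avoiders-headAtLeast m) ≡ ballot m r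
#avoiders-headAtLeast-∑ {zero} z≤n =
  countWords-[] 0 (λ w → avoider? 0 w ×-dec head? (λ v → 0 ≤? toℕ v) w) (((λ ()) , (λ ()) , (λ ())) , tt)
#avoiders-headAtLeast-∑ {suc m} {r} r≤1+m = begin
  ∑< r (#avoiders-headAtLeast (suc m)) + #avoiders-headAtLeast (suc m) r
    ≡⟨ cong₂ _+_ (∑<-cong r λ y y<r → trans (#avoiders-headAtLeast-suc m y) (when-yes (y ≤? m) (≤-pred (<-≤-trans y<r r≤1+m))))
                 (#avoiders-headAtLeast-suc m r) ⟩
  ∑< r (ballot m) + when (r ≤? m) (ballot m r)
    ≡⟨ cong (λ n → ∑< n (ballot m) + when (r ≤? m) (ballot m r)) (m≤n⇒m⊓n≡m r≤1+m) ⟨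
  ballot (suc m) r ∎

#avoiders-firstAscent-suc-zero : ∀ m s → #avoiders-firstAscent (suc m) s 0 ≡ ∑< (s ⊓ suc m) (#avoiders-headAtLeast m)
#avoiders-firstAscent-suc-zero m s = trans
  (countWords-by-first (suc m) m (λ w → avoider? s w ×-dec (head? (λ v → toℕ v <? s) w ×-dec firstAscentAt′? w 1)) _
                       (λ x → #avoiders-firstAscent-first-zero x s))
  (∑<-when-< (suc m) s (#avoiders-headAtLeast m))

#avoiders-firstAscent-suc-suc : ∀ m s j →
  #avoiders-firstAscent (suc m) s (suc j) ≡ ∑< (s ⊓ suc m) (λ y → #avoiders-firstAscent m y j)
#avoiders-firstAscent-suc-suc m s j = trans
  (countWords-by-first (suc m) m (λ w → avoider? s w ×-dec (head? (λ v → toℕ v <? s) w ×-dec firstAscentAt′? w (suc (suc j)))) _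
                       (λ x → #avoiders-firstAscent-first-suc x s j))
  (∑<-when-< (suc m) s (λ y → #avoiders-firstAscent m y j))

#avoiders-firstAscent-closed : ∀ {m j s} → j ≤ m → s ≤ suc m →
  #avoiders-firstAscent (suc m) s j ≡ when (j <? s) (ballot m (s ∸ suc j))
#avoiders-firstAscent-closed {m} {zero} {s} _ s≤1+m =
  trans (#avoiders-firstAscent-suc-zero m s)
        (trans (cong (λ n → ∑< n (#avoiders-headAtLeast m)) (m≤n⇒m⊓n≡m s≤1+m)) (by-cases s s≤1+m))
  where
  by-cases : ∀ s → s ≤ suc m → ∑< s (#avoiders-headAtLeast m) ≡ when (0 <? s) (ballot m (s ∸ 1))
  by-cases zero    _         = refl
  by-cases (suc r) (s≤s r≤m) = #avoiders-headAtLeast-∑ r≤m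
#avoiders-firstAscent-closed {suc m} {suc j} {s} (s≤s j≤m) s≤2+m = begin
  #avoiders-firstAscent (suc (suc m)) s (suc j)
    ≡⟨ #avoiders-firstAscent-suc-suc (suc m) s j ⟩
  ∑< (s ⊓ suc (suc m)) (λ y → #avoiders-firstAscent (suc m) y j)
    ≡⟨ cong (λ n → ∑< n (λ y → #avoiders-firstAscent (suc m) y j)) (m≤n⇒m⊓n≡m s≤2+m) ⟩
  ∑< s (λ y → #avoiders-firstAscent (suc m) y j)
    ≡⟨ ∑<-cong s (λ y y<s → #avoiders-firstAscent-closed j≤m (≤-pred (<-≤-trans y<s s≤2+m))) ⟩
  ∑< s (λ y → when (suc j ≤? y) (ballot m (y ∸ suc j)))
    ≡⟨ ∑<-shift s (suc j) (ballot m) ⟩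
  ∑< (s ∸ suc j) (ballot m)
    ≡⟨ by-cases (suc j <? s) ⟩
  when (suc j <? s) (ballot (suc m) (s ∸ suc (suc j))) ∎
  where
  by-cases : (d : Dec (suc j < s)) → ∑< (s ∸ suc j) (ballot m) ≡ when d (ballot (suc m) (s ∸ suc (suc j)))
  by-cases (yes j<s) = trans (cong (λ n → ∑< n (ballot m)) (+-∸-assoc 1 j<s)) (sym (ballot-∑ bound))
    where
    bound : s ∸ suc (suc j) ≤ m
    bound = ≤-trans (∸-monoˡ-≤ (suc (suc j)) s≤2+m) (m∸n≤m m j)
  by-cases (no j≮s)  = cong (λ n → ∑< n (ballot m)) (m≤n⇒m∸n≡0 (≮⇒≥ j≮s))

count123FirstAscent≡#avoiders-firstAscent : ∀ n j → count123FirstAscent n (suc j) ≡ #avoiders-firstAscent n n j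
count123FirstAscent≡#avoiders-firstAscent n j = countWords-⇔
  (λ w → isPerm? w ×-dec avoids123? w ×-dec firstAscentAt? w (suc j))
  (λ w → avoider? n w ×-dec (head? (λ v → toℕ v <? n) w ×-dec firstAscentAt′? w (suc j)))
  λ w → mk⇔ (λ (p , a , f) → (p , a , nothing-above w) , head-below w , f) (λ ((p , a , _) , _ , f) → p , a , f)
  where
  nothing-above : ∀ {l} (w : Vec (Fin n) l) → DecreasingAbove n w
  nothing-above w i _ _ n≤wi = ⊥-elim (<⇒≱ (Finₚ.toℕ<n (lookup w i)) n≤wi)
  head-below : ∀ {l} (w : Vec (Fin n) l) → Head (λ v → toℕ v < n) w
  head-below []      = tt
  head-below (v ∷ _) = Finₚ.toℕ<n v

2[1+j+s]∸[1+j] : ∀ j s → 2 * suc (j + s) ∸ suc j ≡ suc (j + s + s)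
2[1+j+s]∸[1+j] j s = trans (cong (_∸ suc j) (double j s)) (m+n∸m≡n (suc j) (suc (j + s + s)))
  where
  double : ∀ j s → 2 * suc (j + s) ≡ suc j + suc (j + s + s)
  double = solve-∀

mainTheorem1 : (n k : ℕ) → 1 ≤ n → 1 ≤ k → k ≤ n →
    (count123FirstAscent n k ≡ catConv n k)
    × ((2 * n ∸ k) * catConv n k ≡ k * ((2 * n ∸ k) C n))
mainTheorem1 (suc m) (suc j) _ _ (s≤s j≤m) with s , refl ← m≤n⇒∃[o]m+o≡n j≤m = counting , ratio
  where
  counting : count123FirstAscent (suc (j + s)) (suc j) ≡ catConv (suc (j + s)) (suc j)
  counting = begin
    count123FirstAscent (suc (j + s)) (suc j)                        ≡⟨ count123FirstAscent≡#avoiders-firstAscent (suc (j + s)) j ⟩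
    #avoiders-firstAscent (suc (j + s)) (suc (j + s)) j              ≡⟨ #avoiders-firstAscent-closed (m≤m+n j s) ≤-refl ⟩
    when (j <? suc (j + s)) (ballot (j + s) (j + s ∸ j))            ≡⟨ when-yes (j <? suc (j + s)) (s≤s (m≤m+n j s)) ⟩
    ballot (j + s) (j + s ∸ j)                                       ≡⟨ cong (ballot (j + s)) (m+n∸m≡n j s) ⟩
    ballot (j + s) s                                                 ≡⟨ catConv≡ballot j s ⟨
    catConv (suc (j + s)) (suc j)                                    ∎
  ratio : (2 * suc (j + s) ∸ suc j) * catConv (suc (j + s)) (suc j) ≡ suc j * ((2 * suc (j + s) ∸ suc j) C suc (j + s))
  ratio = begin
    (2 * suc (j + s) ∸ suc j) * catConv (suc (j + s)) (suc j)  ≡⟨ cong₂ _*_ (2[1+j+s]∸[1+j] j s) (catConv≡ballot j s) ⟩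
    suc (j + s + s) * ballot (j + s) s                        ≡⟨ ballot-ratio j s ⟩
    suc j * (suc (j + s + s) C suc (j + s))                   ≡⟨ cong (λ N → suc j * (N C suc (j + s))) (2[1+j+s]∸[1+j] j s) ⟨
    suc j * ((2 * suc (j + s) ∸ suc j) C suc (j + s))         ∎
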